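{- Let $m\geq 3$ and $n$ be even positive integers. Then the stacked-book graph $G_{m,n}=S_m\Box P_n$ satisfies $$rn(G_{m,n})\leq \frac{mn^2}{2}+n-1.$$
   Context: $S_m$ denotes the star on $m$ vertices (one center vertex adjacent to $m-1$ leaves), $m\ge 3$, and $P_n$ the path on $n$ vertices. The stacked-book graph $G_{m,n}=S_m \Box P_n$ is their Cartesian product. For a simple connected graph $G$ with distance $d$ and diameter $\mathrm{diam}(G)$, a radio labeling is a function $f:V(G)\to \mathbb{Z}_{\ge 0}$ such that $|f(u)-f(v)|\geq \mathrm{diam}(G)+1-d(u,v)$ for all distinct $u,v\in V(G)$. The span of $f$ is $\max_{v} f(v)-\min_{v} f(v)$. The radio number $rn(G)$ is the minimum span over all radio labelings of $G$. -}

module Defs where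

open import Data.Nat using (ℕ; zero; suc; _+_; _≤_; ∣_-_∣)
open import Data.Fin using (Fin; toℕ)
open import Data.Product using (_×_; Σ; ∃; _,_)
open import Data.Sum using (_⊎_)
open import Relation.Binary.PropositionalEquality using (_≡_; _≢_)

Rel : Set → Set₁
Rel V = V → V → Set

data Walk {V : Set} (E : Rel V) : V → V → ℕ → Set where
  here : ∀ {u} → Walk E u u 0
  step : ∀ {u v w k} → E u v → Walk E v w k → Walk E u w (suc k)

Dist : {V : Set} → Rel V → V → V → ℕ → Set
Dist E u v k = Walk E u v k × (∀ j → Walk E u v j → k ≤ j)

IsDiam : {V : Set} → Rel V → ℕ → Set
IsDiam {V} E D = (∀ u v k → Dist E u v k → k ≤ D)
               × Σ V (λ u → Σ V (λ v → Dist E u v D))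

IsRadioLabeling : {V : Set} → Rel V → ℕ → (V → ℕ) → Set
IsRadioLabeling E D f =
  ∀ u v → u ≢ v → ∀ k → Dist E u v k → D + 1 ≤ ∣ f u - f v ∣ + k

-- span(f) = max f - min f ≤ B, i.e. all label differences are ≤ B.
SpanAtMost : {V : Set} → (V → ℕ) → ℕ → Set
SpanAtMost f B = ∀ u v → ∣ f u - f v ∣ ≤ B

RadioNumberAtMost : {V : Set} → Rel V → ℕ → ℕ → Set
RadioNumberAtMost E D B = ∃ λ f → IsRadioLabeling E D f × SpanAtMost f B

-- Star S_m on Fin m: vertex 0 is the centre, all others are leaves.
StarAdj : (m : ℕ) → Rel (Fin m)
StarAdj m i j = (toℕ i ≡ 0 × toℕ j ≢ 0) ⊎ (toℕ j ≡ 0 × toℕ i ≢ 0)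

PathAdj : (n : ℕ) → Rel (Fin n)
PathAdj n i j = (suc (toℕ i) ≡ toℕ j) ⊎ (suc (toℕ j) ≡ toℕ i)

CartAdj : {V W : Set} → Rel V → Rel W → Rel (V × W)
CartAdj E F (a , b) (a' , b') = (a ≡ a' × F b b') ⊎ (E a a' × b ≡ b')

StackedBook : (m n : ℕ) → Rel (Fin m × Fin n)
StackedBook m n = CartAdj (StarAdj m) (PathAdj n)

-- Write n = 2h and m = p + 2. The labels come in h rounds of length stride = mn + 3; round t
-- labels the levels t and h + t, which are h apart, alternating between them: the centre of
-- level h + t, then leaves of level t and of level h + t in turn, finally the centre of level t.
-- Consecutive labels differ by h or h + 1 while their vertices are at distance h + 2 or h + 1,
-- which is what diameter n + 1 demands; all other pairs are far enough apart in label or in level.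
-- Distances are bounded below by the level difference plus the distance in the star, and the
-- largest label is h · stride - (h + 1) = mn²/2 + n - 1.
module Submission where

open import Defs
open import Data.Nat using (ℕ; _+_; _*_; _∸_; _/_; _≤_)
open import Data.Nat.Divisibility using (_∣_)

open import Data.Nat using (zero; suc; _<_; z≤n; s≤s; s≤s⁻¹; ∣_-_∣; _≟_; _<?_)
open import Data.Nat.Properties
open import Data.Nat.DivMod using (m*n/n≡m)
open import Data.Nat.Divisibility using (divides)
open import Data.Nat.Tactic.RingSolver using (solve-∀)
open import Data.Fin using (Fin; toℕ) renaming (zero to fzero; suc to fsuc)
open import Data.Fin.Properties using (toℕ-injective; toℕ<n)
open import Data.Product using (_×_; ∃; _,_)
open import Data.Sum using (inj₁; inj₂) renaming (map to ⊎-map; swap to ⊎-swap)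
open import Function using (_∘_)
open import Relation.Nullary using (¬_; yes; no; contradiction)
open import Relation.Binary using (tri<; tri≈; tri>)
open import Relation.Binary.PropositionalEquality
  using (_≡_; _≢_; refl; sym; trans; cong; cong₂; subst; module ≡-Reasoning)

module _ {V : Set} {E : Rel V} where

  _++ʷ_ : ∀ {u v w j k} → Walk E u v j → Walk E v w k → Walk E u w (j + k)
  here     ++ʷ q = q
  step e p ++ʷ q = step e (p ++ʷ q)

  reverseʷ : (∀ {u v} → E u v → E v u) → ∀ {u v k} → Walk E u v k → Walk E v u k
  reverseʷ E-sym here = here
  reverseʷ E-sym {k = suc k} (step e p) =
    subst (Walk E _ _) (+-comm k 1) (reverseʷ E-sym p ++ʷ step (E-sym e) here)

mapʷ : ∀ {V W : Set} {E : Rel V} {F : Rel W} (g : V → W) → (∀ {u v} → E u v → F (g u) (g v)) →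
       ∀ {u v k} → Walk E u v k → Walk F (g u) (g v) k
mapʷ g g-edge here       = here
mapʷ g g-edge (step e p) = step (g-edge e) (mapʷ g g-edge p)

record IsDistanceLowerBound {V : Set} (E : Rel V) (δ : V → V → ℕ) : Set where
  field
    δ-diagonal : ∀ u → δ u u ≡ 0
    δ-edge     : ∀ {u w} v → E u w → δ u v ≤ suc (δ w v)

  walk-length-≥ : ∀ {u v k} → Walk E u v k → δ u v ≤ k
  walk-length-≥ {u} here           = ≤-reflexive (δ-diagonal u)
  walk-length-≥ {v = v} (step e p) = ≤-trans (δ-edge v e) (s≤s (walk-length-≥ p))

open IsDistanceLowerBound

_⊞_ : ∀ {V W : Set} → (V → V → ℕ) → (W → W → ℕ) → V × W → V × W → ℕ
(δ₁ ⊞ δ₂) (a , b) (a' , b') = δ₁ a a' + δ₂ b b'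

□-distanceLowerBound : ∀ {V W : Set} {E : Rel V} {F : Rel W} {δ₁ δ₂} →
  IsDistanceLowerBound E δ₁ → IsDistanceLowerBound F δ₂ →
  IsDistanceLowerBound (CartAdj E F) (δ₁ ⊞ δ₂)
□-distanceLowerBound {E = E} {F} {δ₁} {δ₂} lb₁ lb₂ = record
  { δ-diagonal = λ (a , b) → cong₂ _+_ (δ-diagonal lb₁ a) (δ-diagonal lb₂ b)
  ; δ-edge     = edge
  }
  where
  edge : ∀ {u w} v → CartAdj E F u w → (δ₁ ⊞ δ₂) u v ≤ suc ((δ₁ ⊞ δ₂) w v)
  edge {a , b} {_ , b'} (c , d) (inj₁ (refl , f)) =
    ≤-trans (+-monoʳ-≤ (δ₁ a c) (δ-edge lb₂ d f)) (≤-reflexive (+-suc (δ₁ a c) (δ₂ b' d)))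
  edge {a , b} {_ , _}  (c , d) (inj₂ (e , refl)) = +-monoˡ-≤ (δ₂ b d) (δ-edge lb₁ c e)

diam≤ : ∀ {V : Set} {E : Rel V} {D B} → IsDiam E D →
        (∀ u v → ∃ λ k → k ≤ B × Walk E u v k) → D ≤ B
diam≤ (_ , u , v , _ , shortest) walk with walk u v
... | k , k≤B , w = ≤-trans (shortest k w) k≤B

isRadioLabeling : ∀ {V : Set} {E : Rel V} {δ D B f} → IsDistanceLowerBound E δ → D ≤ B →
  (∀ u v → u ≢ v → suc B ≤ ∣ f u - f v ∣ + δ u v) → IsRadioLabeling E D f
isRadioLabeling {D = D} lb D≤B separated u v u≢v k (w , _) =
  ≤-trans (≤-reflexive (+-comm D 1))
    (≤-trans (s≤s D≤B) (≤-trans (separated u v u≢v) (+-monoʳ-≤ _ (walk-length-≥ lb w))))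

spanAtMost : ∀ {V : Set} {f : V → ℕ} {B} → (∀ u → f u ≤ B) → SpanAtMost f B
spanAtMost {f = f} bounded u v = ≤-trans (∣m-n∣≤m⊔n (f u) (f v)) (⊔-lub (bounded u) (bounded v))

m+n≤o⇒n≤∣o-m∣ : ∀ m o {n} → m + n ≤ o → n ≤ ∣ o - m ∣
m+n≤o⇒n≤∣o-m∣ m o m+n≤o = +-cancelˡ-≤ m _ _ (≤-trans m+n≤o (m≤n+∣m-n∣ o m))

m+n≤o⇒n≤∣m-o∣ : ∀ m o {n} → m + n ≤ o → n ≤ ∣ m - o ∣
m+n≤o⇒n≤∣m-o∣ m o m+n≤o = subst (_ ≤_) (∣-∣-comm o m) (m+n≤o⇒n≤∣o-m∣ m o m+n≤o)

starDist : ℕ → ℕ → ℕ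
starDist zero    zero    = 0
starDist zero    (suc _) = 1
starDist (suc _) zero    = 1
starDist (suc i) (suc j) with i ≟ j
... | yes _ = 0
... | no  _ = 2

starDist-diagonal : ∀ x → starDist x x ≡ 0
starDist-diagonal zero = refl
starDist-diagonal (suc i) with i ≟ i
... | yes _   = refl
... | no  i≢i = contradiction refl i≢i

starDist-comm : ∀ x y → starDist x y ≡ starDist y x
starDist-comm zero    zero    = refl
starDist-comm zero    (suc _) = refl
starDist-comm (suc _) zero    = refl
starDist-comm (suc i) (suc j) with i ≟ j | j ≟ i
... | yes _   | yes _   = refl
... | no  _   | no  _   = refl
... | yes i≡j | no  j≢i = contradiction (sym i≡j) j≢i
... | no  i≢j | yes j≡i = contradiction (sym j≡i) i≢j

starDist-leaves : ∀ {i j} → i ≢ j → starDist (suc i) (suc j) ≡ 2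
starDist-leaves {i} {j} i≢j with i ≟ j
... | yes i≡j = contradiction i≡j i≢j
... | no  _   = refl

starDist≤2 : ∀ x y → starDist x y ≤ 2
starDist≤2 zero    zero    = z≤n
starDist≤2 zero    (suc _) = s≤s z≤n
starDist≤2 (suc _) zero    = s≤s z≤n
starDist≤2 (suc i) (suc j) with i ≟ j
... | yes _ = z≤n
... | no  _ = ≤-refl

starDist-centre≤1 : ∀ y → starDist 0 y ≤ 1
starDist-centre≤1 zero    = z≤n
starDist-centre≤1 (suc _) = ≤-refl

starDist-viaCentre : ∀ x y → starDist x y ≤ suc (starDist 0 y)
starDist-viaCentre zero    zero    = z≤n
starDist-viaCentre (suc _) zero    = ≤-refl
starDist-viaCentre x       (suc y) = starDist≤2 x (suc y)

star-distanceLowerBound : ∀ m →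
  IsDistanceLowerBound (StarAdj m) (λ a a' → starDist (toℕ a) (toℕ a'))
star-distanceLowerBound m = record
  { δ-diagonal = λ a → starDist-diagonal (toℕ a)
  ; δ-edge     = edge
  }
  where
  edge : ∀ {a b} c → StarAdj m a b → starDist (toℕ a) (toℕ c) ≤ suc (starDist (toℕ b) (toℕ c))
  edge c (inj₁ (a≡0 , _)) rewrite a≡0 = ≤-trans (starDist-centre≤1 (toℕ c)) (s≤s z≤n)
  edge {a} c (inj₂ (b≡0 , _)) rewrite b≡0 = starDist-viaCentre (toℕ a) (toℕ c)

path-distanceLowerBound : ∀ n → IsDistanceLowerBound (PathAdj n) (λ b b' → ∣ toℕ b - toℕ b' ∣)
path-distanceLowerBound n = record
  { δ-diagonal = λ b → ∣n-n∣≡0 (toℕ b)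
  ; δ-edge     = edge
  }
  where
  ∣n-1+n∣≡1 : ∀ x → ∣ x - suc x ∣ ≡ 1
  ∣n-1+n∣≡1 x = trans (cong (λ y → ∣ x - y ∣) (+-comm 1 x)) (∣m-m+n∣≡n x 1)

  adjacent : ∀ {a b} → PathAdj n a b → ∣ toℕ a - toℕ b ∣ ≡ 1
  adjacent {a} (inj₁ a+1≡b) rewrite sym a+1≡b = ∣n-1+n∣≡1 (toℕ a)
  adjacent {_} {b} (inj₂ b+1≡a) rewrite sym b+1≡a =
    trans (∣-∣-comm (suc (toℕ b)) (toℕ b)) (∣n-1+n∣≡1 (toℕ b))

  edge : ∀ {a b} c → PathAdj n a b → ∣ toℕ a - toℕ c ∣ ≤ suc ∣ toℕ b - toℕ c ∣
  edge {a} {b} c ab = ≤-trans (∣-∣-triangle (toℕ a) (toℕ b) (toℕ c))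
                              (≤-reflexive (cong (_+ ∣ toℕ b - toℕ c ∣) (adjacent ab)))

stackedBook-distanceLowerBound : ∀ m n →
  IsDistanceLowerBound (StackedBook m n)
    ((λ a a' → starDist (toℕ a) (toℕ a')) ⊞ (λ b b' → ∣ toℕ b - toℕ b' ∣))
stackedBook-distanceLowerBound m n =
  □-distanceLowerBound (star-distanceLowerBound m) (path-distanceLowerBound n)

star-walk : ∀ {m} (a a' : Fin m) → ∃ λ k → k ≤ 2 × Walk (StarAdj m) a a' k
star-walk fzero    fzero     = 0 , z≤n , here
star-walk fzero    (fsuc _)  = 1 , s≤s z≤n , step (inj₁ (refl , λ ())) here
star-walk (fsuc _) fzero     = 1 , s≤s z≤n , step (inj₂ (refl , λ ())) here
star-walk (fsuc _) (fsuc _)  =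
  2 , ≤-refl , step (inj₂ (refl , λ ())) (step (inj₁ (refl , λ ())) here)

path-shift : ∀ {n} {i j : Fin n} → PathAdj n i j → PathAdj (suc n) (fsuc i) (fsuc j)
path-shift = ⊎-map (cong suc) (cong suc)

path-walk-from0 : ∀ {n} (j : Fin (suc n)) → Walk (PathAdj (suc n)) fzero j (toℕ j)
path-walk-from0 fzero = here
path-walk-from0 {suc n} (fsuc j) = step (inj₁ refl) (mapʷ fsuc path-shift (path-walk-from0 j))

path-walk : ∀ {n} (i j : Fin n) → Walk (PathAdj n) i j ∣ toℕ i - toℕ j ∣
path-walk fzero    j        = path-walk-from0 j
path-walk (fsuc i) fzero    = reverseʷ ⊎-swap (path-walk-from0 (fsuc i))
path-walk (fsuc i) (fsuc j) = mapʷ fsuc path-shift (path-walk i j)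

stackedBook-walk : ∀ {m n} (u v : Fin m × Fin n) →
  ∃ λ k → k ≤ suc n × Walk (StackedBook m n) u v k
stackedBook-walk {m} {n} (a , b) (a' , b') with star-walk a a'
... | k , k≤2 , w =
  k + ∣ toℕ b - toℕ b' ∣ , ≤-pred (+-mono-≤-< k≤2 ∣b-b'∣<n) , (along-star ++ʷ along-path)
  where
  ∣b-b'∣<n : ∣ toℕ b - toℕ b' ∣ < n
  ∣b-b'∣<n = ≤-<-trans (∣m-n∣≤m⊔n (toℕ b) (toℕ b')) (⊔-pres-<m (toℕ<n b) (toℕ<n b'))

  along-star : Walk (StackedBook m n) (a , b) (a' , b) k
  along-star = mapʷ (_, b) (λ e → inj₂ (e , refl)) w

  along-path : Walk (StackedBook m n) (a' , b) (a' , b') ∣ toℕ b - toℕ b' ∣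
  along-path = mapʷ (a' ,_) (λ e → inj₁ (refl , e)) (path-walk b b')

∣m+n-n∣≡m : ∀ m n → ∣ m + n - n ∣ ≡ m
∣m+n-n∣≡m m n =
  trans (∣-∣-comm (m + n) n) (trans (cong (λ s → ∣ n - s ∣) (+-comm m n)) (∣m-m+n∣≡n n m))

block-gap : ∀ w {t t' a b c} → t < t' → a + c ≤ w + b → c ≤ ∣ t' * w + b - t * w + a ∣
block-gap w {t} {t'} {a} {b} {c} t<t' a+c≤w+b = m+n≤o⇒n≤∣o-m∣ (t * w + a) (t' * w + b) (begin
  t * w + a + c     ≡⟨ +-assoc (t * w) a c ⟩
  t * w + (a + c)   ≤⟨ +-monoʳ-≤ (t * w) a+c≤w+b ⟩
  t * w + (w + b)   ≡⟨ regroup t w b ⟩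
  suc t * w + b     ≤⟨ +-monoˡ-≤ b (*-monoˡ-≤ w t<t') ⟩
  t' * w + b        ∎)
  where
  open ≤-Reasoning
  regroup : ∀ t w b → t * w + (w + b) ≡ suc t * w + b
  regroup = solve-∀

block-top : ∀ w {t k a c} → t ≤ k → a + c ≤ w → t * w + a + c ≤ suc k * w
block-top w {t} {k} {a} {c} t≤k a+c≤w = begin
  t * w + a + c     ≡⟨ +-assoc (t * w) a c ⟩
  t * w + (a + c)   ≤⟨ +-mono-≤ (*-monoˡ-≤ w t≤k) a+c≤w ⟩
  k * w + w         ≡⟨ +-comm (k * w) w ⟩
  suc k * w         ∎
  where open ≤-Reasoning

n≤∣i*n+c-j*n+c∣ : ∀ n c {i j} → i ≢ j → n ≤ ∣ i * n + c - j * n + c ∣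
n≤∣i*n+c-j*n+c∣ n c {i} {j} i≢j
  rewrite +-comm (i * n) c | +-comm (j * n) c | ∣m+n-m+o∣≡∣n-o∣ c (i * n) (j * n)
        | sym (*-distribʳ-∣-∣ n i j)
  with ∣ i - j ∣ | ∣m-n∣≡0⇒m≡n {i} {j}
... | zero  | i≡j = contradiction (i≡j refl) i≢j
... | suc k | _   = m≤m+n n (k * n)

module Labelling (p h₀ : ℕ) (2≤p : 2 ≤ p) where

  h n m stride : ℕ
  h = suc h₀
  n = h * 2
  m = 2 + p
  stride = m * n + 3

  -- Leaf j + 1 of level t is labelled between the vertices slot j and slot j + 1 of level h + t.
  -- As slot j ∉ {j, j + 1} (this needs 2 ≤ p), its own copy, only h levels away, is never
  -- labelled next to it.
  slot : ℕ → ℕ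
  slot zero    = p
  slot (suc j) = j

  lowOffset : ℕ → ℕ
  lowOffset zero    = suc p * n + (2 + h)
  lowOffset (suc j) = slot j * n + (1 + h)

  highOffset : ℕ → ℕ
  highOffset zero    = 0
  highOffset (suc i) = suc i * n + 1

  label : ℕ → ℕ → ℕ
  label x y with y <? h
  ... | yes _ = y * stride + lowOffset x
  ... | no  _ = (y ∸ h) * stride + highOffset x

  label-low : ∀ x {y} → y < h → label x y ≡ y * stride + lowOffset x
  label-low x {y} y<h with y <? h
  ... | yes _   = refl
  ... | no  y≮h = contradiction y<h y≮h

  label-high : ∀ x t → label x (h + t) ≡ t * stride + highOffset x
  label-high x t with h + t <? h
  ... | yes h+t<h = contradiction h+t<h (m+n≮m h t)
  ... | no  _     = cong (λ s → s * stride + highOffset x) (m+n∸m≡n h t)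

  data Level (y : ℕ) : Set where
    low  : y < h → Level y
    high : ∀ t → y ≡ h + t → Level y

  level : ∀ y → Level y
  level y with y <? h
  ... | yes y<h = low y<h
  ... | no  y≮h = high (y ∸ h) (sym (m+[n∸m]≡n (≮⇒≥ y≮h)))

  slot≤p : ∀ {j} → j < suc p → slot j ≤ p
  slot≤p {zero}  _         = ≤-refl
  slot≤p {suc j} (s≤s j<p) = <⇒≤ j<p

  slot-injective : ∀ {j j'} → j < suc p → j' < suc p → slot j ≡ slot j' → j ≡ j'
  slot-injective {zero}  {zero}   _         _          _    = refl
  slot-injective {zero}  {suc j'} _         (s≤s j'<p) p≡j' = contradiction (sym p≡j') (<⇒≢ j'<p)
  slot-injective {suc j} {zero}   (s≤s j<p) _          j≡p  = contradiction j≡p (<⇒≢ j<p)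
  slot-injective {suc j} {suc j'} _         _          j≡j' = cong suc j≡j'

  slot≢self : ∀ j → slot j ≢ j
  slot≢self zero    = <⇒≢ (≤-trans (s≤s z≤n) 2≤p) ∘ sym
  slot≢self (suc j) = <⇒≢ (n<1+n j)

  slot≢suc : ∀ j → slot j ≢ suc j
  slot≢suc zero    = <⇒≢ 2≤p ∘ sym
  slot≢suc (suc j) = <⇒≢ (m<n⇒m<1+n (n<1+n j))

  1+h≤lowOffset : ∀ x → 1 + h ≤ lowOffset x
  1+h≤lowOffset zero    = ≤-trans (n≤1+n (1 + h)) (m≤n+m (2 + h) (suc p * n))
  1+h≤lowOffset (suc j) = m≤n+m (1 + h) (slot j * n)

  lowOffset≤lowOffset0 : ∀ {x} → x < m → lowOffset x ≤ lowOffset 0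
  lowOffset≤lowOffset0 {zero}  _ = ≤-refl
  lowOffset≤lowOffset0 {suc j} (s≤s j<1+p) =
    +-mono-≤ (*-monoˡ-≤ n (m≤n⇒m≤1+n (slot≤p j<1+p))) (n≤1+n (1 + h))

  highOffset≤highOffset[1+p] : ∀ {x} → x < m → highOffset x ≤ highOffset (suc p)
  highOffset≤highOffset[1+p] {zero}  _           = z≤n
  highOffset≤highOffset[1+p] {suc i} (s≤s i<1+p) = +-monoˡ-≤ 1 (*-monoˡ-≤ n i<1+p)

  lowOffset+1+h≤stride : ∀ {x} → x < m → lowOffset x + (1 + h) ≤ stride
  lowOffset+1+h≤stride x<m =
    ≤-trans (+-monoˡ-≤ (1 + h) (lowOffset≤lowOffset0 x<m)) (≤-reflexive (fills p h₀))
    where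
    fills : ∀ p k → let h = suc k ; n = h * 2 in
            suc p * n + (2 + h) + (1 + h) ≡ (2 + p) * n + 3
    fills = solve-∀

  highOffset+2+n≤stride : ∀ {x} → x < m → highOffset x + (2 + n) ≤ stride
  highOffset+2+n≤stride x<m =
    ≤-trans (+-monoˡ-≤ (2 + n) (highOffset≤highOffset[1+p] x<m)) (≤-reflexive (fills p n))
    where
    fills : ∀ p n → suc p * n + 1 + (2 + n) ≡ (2 + p) * n + 3
    fills = solve-∀

  2+n≡[1+h]+[1+h] : 2 + n ≡ (1 + h) + (1 + h)
  2+n≡[1+h]+[1+h] = halves h
    where
    halves : ∀ h → 2 + h * 2 ≡ (1 + h) + (1 + h)
    halves = solve-∀

  lowOffset-gap : ∀ {x} x' → x < m → lowOffset x + (2 + n) ≤ stride + lowOffset x'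
  lowOffset-gap {x} x' x<m = begin
    lowOffset x + (2 + n)               ≡⟨ cong (lowOffset x +_) 2+n≡[1+h]+[1+h] ⟩
    lowOffset x + ((1 + h) + (1 + h))   ≡⟨ sym (+-assoc (lowOffset x) (1 + h) (1 + h)) ⟩
    lowOffset x + (1 + h) + (1 + h)     ≤⟨ +-mono-≤ (lowOffset+1+h≤stride x<m) (1+h≤lowOffset x') ⟩
    stride + lowOffset x'               ∎
    where open ≤-Reasoning

  highOffset-gap : ∀ {x} x' → x < m → highOffset x + (2 + n) ≤ stride + highOffset x'
  highOffset-gap x' x<m = ≤-trans (highOffset+2+n≤stride x<m) (m≤m+n stride (highOffset x'))

  OffsetSeparated : (ℕ → ℕ) → Set
  OffsetSeparated e =
    ∀ {x x'} → x < m → x' < m → x ≢ x' → 2 + n ≤ starDist x x' + ∣ e x - e x' ∣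

  offsetSeparated : ∀ e →
    (∀ {j} → suc j < m → 1 + n ≤ ∣ e 0 - e (suc j) ∣) →
    (∀ {i j} → suc i < m → suc j < m → i ≢ j → n ≤ ∣ e (suc i) - e (suc j) ∣) →
    OffsetSeparated e
  offsetSeparated e centre leaves {zero}  {zero}  _  _  0≢0 = contradiction refl 0≢0
  offsetSeparated e centre leaves {zero}  {suc j} _  j< _   = s≤s (centre j<)
  offsetSeparated e centre leaves {suc i} {zero}  i< _  _   =
    s≤s (subst (1 + n ≤_) (∣-∣-comm (e 0) (e (suc i))) (centre i<))
  offsetSeparated e centre leaves {suc i} {suc j} i< j< i≢j
    rewrite starDist-leaves (i≢j ∘ cong suc) = +-monoʳ-≤ 2 (leaves i< j< (i≢j ∘ cong suc))

  lowOffset-separated : OffsetSeparated lowOffset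
  lowOffset-separated = offsetSeparated lowOffset centre leaves
    where
    centre : ∀ {j} → suc j < m → 1 + n ≤ ∣ lowOffset 0 - lowOffset (suc j) ∣
    centre {j} (s≤s j<1+p) = m+n≤o⇒n≤∣o-m∣ (lowOffset (suc j)) (lowOffset 0) (begin
      slot j * n + (1 + h) + (1 + n)
        ≤⟨ +-monoˡ-≤ (1 + n) (+-monoˡ-≤ (1 + h) (*-monoˡ-≤ n (slot≤p j<1+p))) ⟩
      p * n + (1 + h) + (1 + n)        ≡⟨ shift p n h ⟩
      suc p * n + (2 + h)              ∎)
      where
      open ≤-Reasoning
      shift : ∀ p n h → p * n + (1 + h) + (1 + n) ≡ suc p * n + (2 + h)
      shift = solve-∀

    leaves : ∀ {i j} → suc i < m → suc j < m → i ≢ j →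
             n ≤ ∣ lowOffset (suc i) - lowOffset (suc j) ∣
    leaves (s≤s i<1+p) (s≤s j<1+p) i≢j =
      n≤∣i*n+c-j*n+c∣ n (1 + h) (i≢j ∘ slot-injective i<1+p j<1+p)

  highOffset-separated : OffsetSeparated highOffset
  highOffset-separated = offsetSeparated highOffset centre leaves
    where
    centre : ∀ {j} → suc j < m → 1 + n ≤ ∣ highOffset 0 - highOffset (suc j) ∣
    centre {j} _ = subst (_≤ n + j * n + 1) (+-comm n 1) (+-monoˡ-≤ 1 (m≤m+n n (j * n)))

    leaves : ∀ {i j} → suc i < m → suc j < m → i ≢ j →
             n ≤ ∣ highOffset (suc i) - highOffset (suc j) ∣
    leaves _ _ i≢j = n≤∣i*n+c-j*n+c∣ n 1 (i≢j ∘ suc-injective)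

  interleave-far : ∀ {a q} → a ≢ q → a ≢ suc q → 2 + h ≤ ∣ a * n + 1 - q * n + (1 + h) ∣
  interleave-far {a} {q} a≢q a≢1+q with <-cmp a q
  ... | tri< a<q _ _ = m+n≤o⇒n≤∣m-o∣ (a * n + 1) (q * n + (1 + h)) (begin
    a * n + 1 + (2 + h)            ≤⟨ m≤m+n _ (h₀ * 2) ⟩
    a * n + 1 + (2 + h) + h₀ * 2   ≡⟨ spread a h₀ ⟩
    suc a * n + (1 + h)            ≤⟨ +-monoˡ-≤ (1 + h) (*-monoˡ-≤ n a<q) ⟩
    q * n + (1 + h)                ∎)
    where
    open ≤-Reasoning
    spread : ∀ a k → let h = suc k ; n = h * 2 in
             a * n + 1 + (2 + h) + k * 2 ≡ suc a * n + (1 + h)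
    spread = solve-∀
  ... | tri≈ _ a≡q _ = contradiction a≡q a≢q
  ... | tri> _ _ q<a = m+n≤o⇒n≤∣o-m∣ (q * n + (1 + h)) (a * n + 1) (begin
    q * n + (1 + h) + (2 + h)            ≤⟨ m≤m+n _ (h₀ * 2) ⟩
    q * n + (1 + h) + (2 + h) + h₀ * 2   ≡⟨ spread q h₀ ⟩
    suc (suc q) * n + 1                  ≤⟨ +-monoˡ-≤ 1 (*-monoˡ-≤ n 2+q≤a) ⟩
    a * n + 1                            ∎)
    where
    open ≤-Reasoning
    2+q≤a : 2 + q ≤ a
    2+q≤a = ≤∧≢⇒< q<a (a≢1+q ∘ sym)
    spread : ∀ q k → let h = suc k ; n = h * 2 in
             q * n + (1 + h) + (2 + h) + k * 2 ≡ suc (suc q) * n + 1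
    spread = solve-∀

  interleave-same : ∀ a → h ≤ ∣ a * n + 1 - a * n + (1 + h) ∣
  interleave-same a = ≤-reflexive (sym (∣m+n-m+o∣≡∣n-o∣ (a * n) 1 (1 + h)))

  interleave-next : ∀ q → h ≤ ∣ suc q * n + 1 - q * n + (1 + h) ∣
  interleave-next q = m+n≤o⇒n≤∣o-m∣ (q * n + (1 + h)) (suc q * n + 1) (≤-reflexive (fills q h))
    where
    fills : ∀ q h → q * (h * 2) + (1 + h) + h ≡ suc q * (h * 2) + 1
    fills = solve-∀

  highLowOffset-separated : ∀ {x x'} → x < m → x' < m →
    2 + h ≤ starDist x x' + ∣ highOffset x - lowOffset x' ∣
  highLowOffset-separated {zero}  {zero}  _ _ = m≤n+m (2 + h) (suc p * n)
  highLowOffset-separated {zero}  {suc j} _ _ = s≤s (1+h≤lowOffset (suc j))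
  highLowOffset-separated {suc i} {zero}  (s≤s i<1+p) _ =
    s≤s (m+n≤o⇒n≤∣m-o∣ (suc i * n + 1) (lowOffset 0) (begin
      suc i * n + 1 + (1 + h)   ≤⟨ +-monoˡ-≤ (1 + h) (+-monoˡ-≤ 1 (*-monoˡ-≤ n i<1+p)) ⟩
      suc p * n + 1 + (1 + h)   ≡⟨ +-assoc (suc p * n) 1 (1 + h) ⟩
      suc p * n + (2 + h)       ∎))
    where open ≤-Reasoning
  highLowOffset-separated {suc i} {suc j} _ _ with suc i ≟ slot j | i ≟ slot j
  ... | yes 1+i≡s | _
    rewrite starDist-leaves (λ i≡j → slot≢suc j (trans (sym 1+i≡s) (cong suc i≡j))) =
    +-monoʳ-≤ 2 (subst (λ q → h ≤ ∣ suc i * n + 1 - q * n + (1 + h) ∣) 1+i≡s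
                       (interleave-same (suc i)))
  ... | no _ | yes i≡s
    rewrite starDist-leaves (λ i≡j → slot≢self j (trans (sym i≡s) i≡j)) =
    +-monoʳ-≤ 2 (subst (λ q → h ≤ ∣ suc i * n + 1 - q * n + (1 + h) ∣) i≡s
                       (interleave-next i))
  ... | no 1+i≢s | no i≢s =
    ≤-trans (interleave-far 1+i≢s (i≢s ∘ suc-injective)) (m≤n+m _ (starDist (suc i) (suc j)))

  sameHalf-separated : ∀ e → OffsetSeparated e →
    (∀ {x} x' → x < m → e x + (2 + n) ≤ stride + e x') →
    ∀ {x x'} t t' → x < m → x' < m → ¬ (x ≡ x' × t ≡ t') →
    2 + n ≤ ∣ t * stride + e x - t' * stride + e x' ∣ + (starDist x x' + ∣ t - t' ∣)
  sameHalf-separated e separated gap {x} {x'} t t' x<m x'<m ≢ with <-cmp t t'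
  ... | tri< t<t' _ _ = ≤-trans labels-apart (m≤m+n _ _)
    where
    labels-apart : 2 + n ≤ ∣ t * stride + e x - t' * stride + e x' ∣
    labels-apart = subst (2 + n ≤_) (∣-∣-comm (t' * stride + e x') (t * stride + e x))
                         (block-gap stride t<t' (gap x' x<m))
  ... | tri≈ _ refl _
    rewrite ∣m+n-m+o∣≡∣n-o∣ (t * stride) (e x) (e x') | ∣n-n∣≡0 t | +-identityʳ (starDist x x')
          | +-comm ∣ e x - e x' ∣ (starDist x x') =
    separated x<m x'<m (λ x≡x' → ≢ (x≡x' , refl))
  ... | tri> _ _ t'<t = ≤-trans (block-gap stride t'<t (gap x x'<m)) (m≤m+n _ _)

  highLow-separated : ∀ {x x'} t t' → x < m → x' < m →
    2 + n ≤ ∣ t * stride + highOffset x - t' * stride + lowOffset x' ∣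
            + (starDist x x' + ∣ h + t - t' ∣)
  highLow-separated {x} {x'} t t' x<m x'<m with <-cmp t t'
  ... | tri< t<t' _ _ = ≤-trans labels-apart (m≤m+n _ _)
    where
    labels-apart : 2 + n ≤ ∣ t * stride + highOffset x - t' * stride + lowOffset x' ∣
    labels-apart =
      subst (2 + n ≤_) (∣-∣-comm (t' * stride + lowOffset x') (t * stride + highOffset x))
        (block-gap stride t<t' (≤-trans (highOffset+2+n≤stride x<m) (m≤m+n stride (lowOffset x'))))
  ... | tri≈ _ refl _
    rewrite ∣m+n-m+o∣≡∣n-o∣ (t * stride) (highOffset x) (lowOffset x') | ∣m+n-n∣≡m h t = begin
    2 + n                     ≡⟨ double h ⟩
    2 + h + h                 ≤⟨ +-monoˡ-≤ h (highLowOffset-separated x<m x'<m) ⟩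
    starDist x x' + d + h     ≡⟨ regroup (starDist x x') d h ⟩
    d + (starDist x x' + h)   ∎
    where
    open ≤-Reasoning
    d = ∣ highOffset x - lowOffset x' ∣
    double : ∀ h → 2 + h * 2 ≡ 2 + h + h
    double = solve-∀
    regroup : ∀ s d h → s + d + h ≡ d + (s + h)
    regroup = solve-∀
  ... | tri> _ _ t'<t = begin
    2 + n               ≡⟨ 2+n≡[1+h]+[1+h] ⟩
    (1 + h) + (1 + h)   ≤⟨ +-mono-≤ labels-apart (≤-trans levels-apart (m≤n+m _ (starDist x x'))) ⟩
    ∣ t * stride + highOffset x - t' * stride + lowOffset x' ∣ + (starDist x x' + ∣ h + t - t' ∣) ∎
    where
    open ≤-Reasoning
    labels-apart : 1 + h ≤ ∣ t * stride + highOffset x - t' * stride + lowOffset x' ∣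
    labels-apart =
      block-gap stride t'<t (≤-trans (lowOffset+1+h≤stride x'<m) (m≤m+n stride (highOffset x)))
    levels-apart : 1 + h ≤ ∣ h + t - t' ∣
    levels-apart =
      m+n≤o⇒n≤∣o-m∣ t' (h + t) (≤-trans (≤-reflexive (shift t' h)) (+-monoʳ-≤ h t'<t))
      where
      shift : ∀ t' h → t' + (1 + h) ≡ h + suc t'
      shift = solve-∀

  Separated : ℕ → ℕ → ℕ → ℕ → Set
  Separated x y x' y' = 2 + n ≤ ∣ label x y - label x' y' ∣ + (starDist x x' + ∣ y - y' ∣)

  Separated-sym : ∀ {x y x' y'} → Separated x' y' x y → Separated x y x' y'
  Separated-sym {x} {y} {x'} {y'}
    rewrite ∣-∣-comm (label x y) (label x' y') | starDist-comm x x' | ∣-∣-comm y y' = λ s → s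

  separated-high-low : ∀ {x x' y'} t → x < m → x' < m → y' < h → Separated x (h + t) x' y'
  separated-high-low {x} {x'} {y'} t x<m x'<m y'<h rewrite label-high x t | label-low x' y'<h =
    highLow-separated t y' x<m x'<m

  separated : ∀ {x x'} y y' → x < m → x' < m → ¬ (x ≡ x' × y ≡ y') → Separated x y x' y'
  separated {x} {x'} y y' x<m x'<m ≢ with level y | level y'
  ... | low y<h | low y'<h rewrite label-low x y<h | label-low x' y'<h =
    sameHalf-separated lowOffset lowOffset-separated lowOffset-gap y y' x<m x'<m ≢
  ... | high t refl | high t' refl
    rewrite label-high x t | label-high x' t' | ∣m+n-m+o∣≡∣n-o∣ h t t' =
    sameHalf-separated highOffset highOffset-separated highOffset-gap t t' x<m x'<m
      (λ (x≡x' , t≡t') → ≢ (x≡x' , cong (h +_) t≡t'))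
  ... | high t refl | low y'<h = separated-high-low t x<m x'<m y'<h
  ... | low y<h | high t' refl = Separated-sym {x} {y} {x'} (separated-high-low t' x'<m x<m y<h)

  label+1+h≤h*stride : ∀ {x y} → x < m → y < n → label x y + (1 + h) ≤ h * stride
  label+1+h≤h*stride {x} {y} x<m y<n with level y
  ... | low y<h rewrite label-low x y<h = block-top stride (s≤s⁻¹ y<h) (lowOffset+1+h≤stride x<m)
  ... | high t refl rewrite label-high x t = block-top stride (s≤s⁻¹ t<h)
    (≤-trans (+-monoʳ-≤ (highOffset x) 1+h≤2+n) (highOffset+2+n≤stride x<m))
    where
    1+h≤2+n : 1 + h ≤ 2 + n
    1+h≤2+n = m≤n⇒m≤1+n (s≤s (m≤m*n h 2))
    t<h : t < h
    t<h = +-cancelˡ-< h t h (subst (h + t <_) (twice h) y<n)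
      where
      twice : ∀ h → h * 2 ≡ h + h
      twice = solve-∀

  span+1+h≡h*stride : m * n * n / 2 + n ∸ 1 + (1 + h) ≡ h * stride
  span+1+h≡h*stride = begin
    m * n * n / 2 + n ∸ 1 + (1 + h)   ≡⟨ cong (λ s → s + n ∸ 1 + (1 + h)) half ⟩
    m * n * h + n ∸ 1 + (1 + h)       ≡⟨ cong (_+ (1 + h)) (+-∸-assoc (m * n * h) 1≤n) ⟩
    m * n * h + (n ∸ 1) + (1 + h)     ≡⟨ fills p h₀ ⟩
    h * stride                        ∎
    where
    open ≡-Reasoning
    1≤n : 1 ≤ n
    1≤n = s≤s z≤n
    half : m * n * n / 2 ≡ m * n * h
    half = trans (cong (_/ 2) (sym (*-assoc (m * n) h 2))) (m*n/n≡m (m * n * h) 2)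
    fills : ∀ p k → let h = suc k ; n = h * 2 ; m = 2 + p in
            m * n * h + suc (k * 2) + (1 + h) ≡ h * (m * n + 3)
    fills = solve-∀

stackedBook-radioNumber≤ : ∀ p h → 2 ≤ p → 1 ≤ h → ∀ D →
  IsDiam (StackedBook (2 + p) (h * 2)) D →
  RadioNumberAtMost (StackedBook (2 + p) (h * 2)) D ((2 + p) * (h * 2) * (h * 2) / 2 + h * 2 ∸ 1)
stackedBook-radioNumber≤ p (suc h₀) 2≤p (s≤s z≤n) D diam = f , radio , span
  where
  open Labelling p h₀ 2≤p

  f : Fin m × Fin n → ℕ
  f (a , b) = label (toℕ a) (toℕ b)

  radio : IsRadioLabeling (StackedBook m n) D f
  radio = isRadioLabeling {f = f} (stackedBook-distanceLowerBound m n) (diam≤ diam stackedBook-walk)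
    λ (a , b) (a' , b') u≢v → separated (toℕ b) (toℕ b') (toℕ<n a) (toℕ<n a')
      λ (a≡a' , b≡b') → u≢v (cong₂ _,_ (toℕ-injective a≡a') (toℕ-injective b≡b'))

  span : SpanAtMost f (m * n * n / 2 + n ∸ 1)
  span = spanAtMost λ (a , b) → +-cancelʳ-≤ (1 + h) _ _
    (subst (f (a , b) + (1 + h) ≤_) (sym span+1+h≡h*stride) (label+1+h≤h*stride (toℕ<n a) (toℕ<n b)))

theorem3p9 : (m n : ℕ) → 3 ≤ m → 2 ∣ m → 1 ≤ n → 2 ∣ n →
    (D : ℕ) → IsDiam (StackedBook m n) D →
    RadioNumberAtMost (StackedBook m n) D (m * n * n / 2 + n ∸ 1)
theorem3p9 _ _ () (divides zero refl) _ _
theorem3p9 _ _ (s≤s (s≤s ())) (divides 1 refl) _ _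
theorem3p9 _ _ _ (divides (suc (suc r)) refl) () (divides zero refl)
theorem3p9 _ _ _ (divides (suc (suc r)) refl) _ (divides (suc h) refl) =
  stackedBook-radioNumber≤ (suc r * 2) (suc h) (s≤s (s≤s z≤n)) (s≤s z≤n)
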